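{- Let $\mathbf{A}$ be a tense DRL-algebra and let $S$ be a tense filter of $C(\mathbf{A})$. Then $D_S=\{u\in A: u\vee c\in S\text{ and }c\Rightarrow u\in S\}$ is a tense filter of $\mathbf{A}$.
   Context: A DRL-algebra is a structure $\langle A,\vee,\wedge,\ast,\sim,c,0,1\rangle$ such that, with $x\Rightarrow y:=\sim(x\ast(\sim y))$, $\langle A,\vee,\wedge,\ast,\Rightarrow,0,1\rangle$ is an integral commutative residuated lattice, $\sim$ is an involutive dual lattice automorphism, $\sim c=c$, and $(x\ast y)\wedge c=((x\wedge c)\ast y)\vee(x\ast(y\wedge c))$. A tense DRL-algebra is a DRL-algebra with unary $G,H$ such that, with $F(x):=\sim G(\sim x)$, $P(x):=\sim H(\sim x)$: (t0) $G(1)=H(1)=1$; (t1) $G(c)=H(c)=c$; (t2) $G,H$ preserve $\wedge$; (t3) $x\le GP(x)$, $x\le HF(x)$; (t4) $G(x\vee y)\le G(x)\vee F(y)$, $H(x\vee y)\le H(x)\vee P(y)$; (t5) $G(x\Rightarrow y)\le G(x)\Rightarrow G(y)$, $H(x\Rightarrow y)\le H(x)\Rightarrow H(y)$. A tense filter of $\mathbf{A}$ is a nonempty up-set closed under $\ast$, $G$ and $H$. $C(\mathbf{A})$ is the tense ICRDL-algebra on $C(A)=\{x\in A:x\ge c\}$ with $\vee,\wedge$ of $A$, product $x\cdot y=(x\ast y)\vee c$, $x\to y=\sim(x\ast(\sim y))$, bottom $c$, top $1$, and $G,H,F,P$ restricted from $A$; a tense filter of $C(\mathbf{A})$ is a nonempty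 up-set of $C(A)$ closed under $\cdot$, $G$ and $H$. -}

module Defs where

open import Level using (Level; _⊔_; suc)
open import Data.Product using (Σ; _×_; _,_)
open import Relation.Binary.PropositionalEquality using (_≡_)
open import Algebra.Core using (Op₁; Op₂)
open import Algebra.Structures using (IsCommutativeMonoid)
open import Algebra.Lattice.Structures using (IsLattice)

record TenseDRL (a : Level) : Set (suc a) where
  infixr 7 _∗_
  infixr 6 _∧_
  infixr 5 _∨_
  infixr 4 _⇒_
  infix 3 _≤_
  field
    Carrier : Set a
    _∨_ _∧_ _∗_ : Op₂ Carrier
    ∼ : Op₁ Carrier
    c 𝟘 𝟙 : Carrier
    G H : Op₁ Carrier

  _≤_ : Carrier → Carrier → Set a
  _≤_ = λ x y → x ∧ y ≡ x

  _⇒_ : Op₂ Carrier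
  _⇒_ = λ x y → ∼ (x ∗ ∼ y)

  F : Op₁ Carrier
  F = λ x → ∼ (G (∼ x))
  P : Op₁ Carrier
  P = λ x → ∼ (H (∼ x))

  field
    isLattice   : IsLattice _≡_ _∨_ _∧_
    isCommMonoid : IsCommutativeMonoid _≡_ _∗_ 𝟙
    bottom      : ∀ x → 𝟘 ≤ x
    integral    : ∀ x → x ≤ 𝟙
    residuation₁ : ∀ x y z → x ∗ y ≤ z → x ≤ y ⇒ z
    residuation₂ : ∀ x y z → x ≤ y ⇒ z → x ∗ y ≤ z
    ∼-invol     : ∀ x → ∼ (∼ x) ≡ x
    ∼-∨         : ∀ x y → ∼ (x ∨ y) ≡ ∼ x ∧ ∼ y
    ∼-∧         : ∀ x y → ∼ (x ∧ y) ≡ ∼ x ∨ ∼ y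
    ∼c          : ∼ c ≡ c
    c-law       : ∀ x y → (x ∗ y) ∧ c ≡ ((x ∧ c) ∗ y) ∨ (x ∗ (y ∧ c))
    t0G : G 𝟙 ≡ 𝟙
    t0H : H 𝟙 ≡ 𝟙
    t1G : G c ≡ c
    t1H : H c ≡ c
    t2G : ∀ x y → G (x ∧ y) ≡ G x ∧ G y
    t2H : ∀ x y → H (x ∧ y) ≡ H x ∧ H y
    t3G : ∀ x → x ≤ G (P x)
    t3H : ∀ x → x ≤ H (F x)
    t4G : ∀ x y → G (x ∨ y) ≤ G x ∨ F y
    t4H : ∀ x y → H (x ∨ y) ≤ H x ∨ P y
    t5G : ∀ x y → G (x ⇒ y) ≤ G x ⇒ G y
    t5H : ∀ x y → H (x ⇒ y) ≤ H x ⇒ H y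

module _ {a : Level} (𝐀 : TenseDRL a) where
  open TenseDRL 𝐀

  record IsTenseFilter {ℓ : Level} (S : Carrier → Set ℓ) : Set (a ⊔ ℓ) where
    field
      nonempty : Σ Carrier S
      upset    : ∀ x y → S x → x ≤ y → S y
      ∗-closed : ∀ x y → S x → S y → S (x ∗ y)
      G-closed : ∀ x → S x → S (G x)
      H-closed : ∀ x → S x → S (H x)

  -- A tense filter of C(𝐀): a subset of C(A) = {x | c ≤ x}, nonempty,
  -- up-closed in C(A), closed under x · y = (x ∗ y) ∨ c, G and H.
  record IsTenseFilterC {ℓ : Level} (S : Carrier → Set ℓ) : Set (a ⊔ ℓ) where
    field
      ⊆C       : ∀ x → S x → c ≤ x
      nonempty : Σ Carrier S
      upset    : ∀ x y → S x → x ≤ y → c ≤ y → S y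
      ·-closed : ∀ x y → S x → S y → S ((x ∗ y) ∨ c)
      G-closed : ∀ x → S x → S (G x)
      H-closed : ∀ x → S x → S (H x)

  D : {ℓ : Level} → (Carrier → Set ℓ) → Carrier → Set ℓ
  D S u = S (u ∨ c) × S (c ⇒ u)

module Submission where

-- Membership of u in D_S is tested on the two elements u ∨ c and c ⇒ u of C(A), so each
-- closure property of D_S follows from the corresponding one of S and an inequality in A:
-- (u ∨ c)·(v ∨ c) ≤ (u ∗ v) ∨ c and (u ∨ c)·(c ⇒ v) ≤ c ⇒ (u ∗ v) for ∗, the latter
-- because c ∗ c ≤ 0 (c is its own negation); G(u ∨ c) ≤ G u ∨ F c = G u ∨ c and
-- G(c ⇒ u) ≤ G c ⇒ G u = c ⇒ G u for G, and the same for H.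

open import Defs
open import Level using (Level)
open import Algebra.Core using (Op₁; Op₂)
open import Data.Product using (_,_; proj₁; proj₂)
open import Relation.Binary.PropositionalEquality
  using (_≡_; sym; cong; isEquivalence)
open import Algebra.Structures using (IsCommutativeMonoid)
open import Algebra.Lattice.Structures using (IsLattice)
open import Algebra.Lattice.Bundles using (Lattice)
import Algebra.Lattice.Properties.Lattice as LatticeProperties
import Relation.Binary.Lattice as OrderLattice
import Relation.Binary.Lattice.Properties.JoinSemilattice as JoinSemilatticeProperties
import Relation.Binary.Reasoning.PartialOrder as ≤-Reasoning

module DRLProperties {a : Level} (𝐀 : TenseDRL a) where
  open TenseDRL 𝐀
  open IsCommutativeMonoid isCommMonoid using (assoc; comm; identityˡ; identityʳ)
  open IsLattice isLattice using (∧-comm)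

  lattice : Lattice a a
  lattice = record { isLattice = isLattice }

  ≤-isJoinSemilattice : OrderLattice.IsJoinSemilattice _≡_ _≤_ _∨_
  ≤-isJoinSemilattice = record
    { isPartialOrder = record
      { isPreorder = record
        { isEquivalence = isEquivalence
        ; reflexive     = λ p → sym (reflexive p)
        ; trans         = λ p q → sym (trans (sym p) (sym q))
        }
      ; antisym = λ p q → antisym (sym p) (sym q)
      }
    ; supremum = λ x y → let x≤x∨y , y≤x∨y , least = supremum x y
                         in sym x≤x∨y , sym y≤x∨y , λ z p q → sym (least z (sym p) (sym q))
    }
    where
    -- the library's order on a lattice is x ≡ x ∧ y, the mirror image of ours
    open OrderLattice.Lattice (LatticeProperties.∨-∧-orderTheoreticLattice lattice)
      using (reflexive; trans; antisym; supremum)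

  ≤-joinSemilattice : OrderLattice.JoinSemilattice a a a
  ≤-joinSemilattice = record { isJoinSemilattice = ≤-isJoinSemilattice }

  open OrderLattice.JoinSemilattice ≤-joinSemilattice public
    using (poset; x≤x∨y; y≤x∨y; ∨-least)
    renaming (refl to ≤-refl; reflexive to ≤-reflexive; trans to ≤-trans; antisym to ≤-antisym)
  open JoinSemilatticeProperties ≤-joinSemilattice public using (∨-monotonic; x≤y⇒x∨y≈y)
  open ≤-Reasoning poset

  ∗-monoˡ : ∀ {x y} z → x ≤ y → x ∗ z ≤ y ∗ z
  ∗-monoˡ {y = y} z x≤y = residuation₂ _ z _ (≤-trans x≤y (residuation₁ y z _ ≤-refl))

  ∗-monoʳ : ∀ z {x y} → x ≤ y → z ∗ x ≤ z ∗ y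
  ∗-monoʳ z {x} {y} x≤y = begin
    z ∗ x ≡⟨ comm z x ⟩
    x ∗ z ≤⟨ ∗-monoˡ z x≤y ⟩
    y ∗ z ≡⟨ comm y z ⟩
    z ∗ y ∎

  ∗-decreasingʳ : ∀ x y → x ∗ y ≤ y
  ∗-decreasingʳ x y = begin
    x ∗ y ≤⟨ ∗-monoˡ y (integral x) ⟩
    𝟙 ∗ y ≡⟨ identityˡ y ⟩
    y     ∎

  ∗-decreasingˡ : ∀ x y → x ∗ y ≤ x
  ∗-decreasingˡ x y = begin
    x ∗ y ≡⟨ comm x y ⟩
    y ∗ x ≤⟨ ∗-decreasingʳ y x ⟩
    x     ∎

  ∗-distribʳ-∨ : ∀ x y z → (x ∨ y) ∗ z ≤ (x ∗ z) ∨ (y ∗ z)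
  ∗-distribʳ-∨ x y z = residuation₂ (x ∨ y) z _
    (∨-least (residuation₁ x z _ (x≤x∨y _ _)) (residuation₁ y z _ (y≤x∨y _ _)))

  [x∨z]∗y≤x∗y∨z : ∀ x y z → (x ∨ z) ∗ y ≤ (x ∗ y) ∨ z
  [x∨z]∗y≤x∗y∨z x y z = begin
    (x ∨ z) ∗ y       ≤⟨ ∗-distribʳ-∨ x z y ⟩
    (x ∗ y) ∨ (z ∗ y) ≤⟨ ∨-monotonic ≤-refl (∗-decreasingˡ z y) ⟩
    (x ∗ y) ∨ z       ∎

  ⇒-mp : ∀ x y → (x ⇒ y) ∗ x ≤ y
  ⇒-mp x y = residuation₂ (x ⇒ y) x y ≤-refl

  ⇒-monoʳ : ∀ z {x y} → x ≤ y → z ⇒ x ≤ z ⇒ y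
  ⇒-monoʳ z {x} x≤y = residuation₁ _ z _ (≤-trans (⇒-mp z x) x≤y)

  ≤⇒𝟙 : ∀ x y → x ≤ y ⇒ 𝟙
  ≤⇒𝟙 x y = residuation₁ x y 𝟙 (integral _)

  ∼-antitone : ∀ {x y} → x ≤ y → ∼ y ≤ ∼ x
  ∼-antitone {x} {y} x≤y = begin-equality
    ∼ y ∧ ∼ x ≡⟨ ∧-comm (∼ y) (∼ x) ⟩
    ∼ x ∧ ∼ y ≡⟨ sym (∼-∨ x y) ⟩
    ∼ (x ∨ y) ≡⟨ cong ∼ (x≤y⇒x∨y≈y x≤y) ⟩
    ∼ y       ∎

  ∼𝟘≡𝟙 : ∼ 𝟘 ≡ 𝟙
  ∼𝟘≡𝟙 = ≤-antisym (integral (∼ 𝟘)) (begin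
    𝟙       ≡⟨ sym (∼-invol 𝟙) ⟩
    ∼ (∼ 𝟙) ≤⟨ ∼-antitone (bottom (∼ 𝟙)) ⟩
    ∼ 𝟘     ∎)

  c∗c≤𝟘 : c ∗ c ≤ 𝟘
  c∗c≤𝟘 = residuation₂ c c 𝟘 (begin
    c         ≡⟨ sym ∼c ⟩
    ∼ c       ≡⟨ cong ∼ (sym (identityʳ c)) ⟩
    ∼ (c ∗ 𝟙) ≡⟨ cong (λ t → ∼ (c ∗ t)) (sym ∼𝟘≡𝟙) ⟩
    c ⇒ 𝟘     ∎)

  c≤c⇒ : ∀ x → c ≤ c ⇒ x
  c≤c⇒ x = residuation₁ c c x (≤-trans c∗c≤𝟘 (bottom x))

  infixr 7 _·_
  _·_ : Op₂ Carrier
  x · y = (x ∗ y) ∨ c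

  [x∨c]·[y∨c]≤x∗y∨c : ∀ x y → (x ∨ c) · (y ∨ c) ≤ (x ∗ y) ∨ c
  [x∨c]·[y∨c]≤x∗y∨c x y = ∨-least (begin
    (x ∨ c) ∗ (y ∨ c)   ≤⟨ [x∨z]∗y≤x∗y∨z x (y ∨ c) c ⟩
    (x ∗ (y ∨ c)) ∨ c   ≡⟨ cong (_∨ c) (comm x (y ∨ c)) ⟩
    ((y ∨ c) ∗ x) ∨ c   ≤⟨ ∨-monotonic ([x∨z]∗y≤x∗y∨z y x c) ≤-refl ⟩
    ((y ∗ x) ∨ c) ∨ c   ≤⟨ ∨-least (∨-monotonic (≤-reflexive (comm y x)) ≤-refl) (y≤x∨y _ _) ⟩
    (x ∗ y) ∨ c         ∎) (y≤x∨y _ _)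

  [x∨c]·[c⇒y]≤c⇒x∗y : ∀ x y → (x ∨ c) · (c ⇒ y) ≤ c ⇒ (x ∗ y)
  [x∨c]·[c⇒y]≤c⇒x∗y x y = ∨-least (residuation₁ _ c _ (begin
    ((x ∨ c) ∗ (c ⇒ y)) ∗ c                ≡⟨ assoc (x ∨ c) (c ⇒ y) c ⟩
    (x ∨ c) ∗ ((c ⇒ y) ∗ c)                ≤⟨ ∗-distribʳ-∨ x c _ ⟩
    (x ∗ ((c ⇒ y) ∗ c)) ∨ (c ∗ ((c ⇒ y) ∗ c))
      ≤⟨ ∨-least (∗-monoʳ x (⇒-mp c y)) (begin
           c ∗ ((c ⇒ y) ∗ c) ≤⟨ ∗-monoʳ c (∗-decreasingʳ (c ⇒ y) c) ⟩
           c ∗ c             ≤⟨ c∗c≤𝟘 ⟩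
           𝟘                 ≤⟨ bottom (x ∗ y) ⟩
           x ∗ y             ∎) ⟩
    x ∗ y                                  ∎)) (c≤c⇒ (x ∗ y))

module _ {a ℓ : Level} (𝐀 : TenseDRL a) (S : TenseDRL.Carrier 𝐀 → Set ℓ)
         (S-filter : IsTenseFilterC 𝐀 S) where
  open TenseDRL 𝐀
  open DRLProperties 𝐀
  open IsTenseFilterC S-filter
  open ≤-Reasoning poset

  S-upward : ∀ {x y} → S x → x ≤ y → S y
  S-upward {x} x∈S x≤y = upset x _ x∈S x≤y (≤-trans (⊆C x x∈S) x≤y)

  𝟙∈D : D 𝐀 S 𝟙
  𝟙∈D = S-upward s∈S (≤-trans (integral s) (x≤x∨y 𝟙 c)) , S-upward s∈S (≤⇒𝟙 s c)
    where
    s = proj₁ nonempty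
    s∈S = proj₂ nonempty

  D-upward : ∀ x y → D 𝐀 S x → x ≤ y → D 𝐀 S y
  D-upward x y (x∨c∈S , c⇒x∈S) x≤y =
    S-upward x∨c∈S (∨-monotonic x≤y ≤-refl) , S-upward c⇒x∈S (⇒-monoʳ c x≤y)

  D-∗-closed : ∀ x y → D 𝐀 S x → D 𝐀 S y → D 𝐀 S (x ∗ y)
  D-∗-closed x y (x∨c∈S , _) (y∨c∈S , c⇒y∈S) =
      S-upward (·-closed _ _ x∨c∈S y∨c∈S) ([x∨c]·[y∨c]≤x∗y∨c x y)
    , S-upward (·-closed _ _ x∨c∈S c⇒y∈S) ([x∨c]·[c⇒y]≤c⇒x∗y x y)

  D-closed-under : (T : Op₁ Carrier) → T c ≡ c
    → (∀ x y → T (x ∨ y) ≤ T x ∨ ∼ (T (∼ y)))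
    → (∀ x y → T (x ⇒ y) ≤ T x ⇒ T y)
    → (∀ x → S x → S (T x))
    → ∀ x → D 𝐀 S x → D 𝐀 S (T x)
  D-closed-under T Tc≡c T-∨ T-⇒ S-T-closed x (x∨c∈S , c⇒x∈S) =
      S-upward (S-T-closed _ x∨c∈S) T[x∨c]≤Tx∨c
    , S-upward (S-T-closed _ c⇒x∈S) T[c⇒x]≤c⇒Tx
    where
    T[x∨c]≤Tx∨c : T (x ∨ c) ≤ T x ∨ c
    T[x∨c]≤Tx∨c = begin
      T (x ∨ c)           ≤⟨ T-∨ x c ⟩
      T x ∨ ∼ (T (∼ c))   ≡⟨ cong (λ t → T x ∨ ∼ (T t)) ∼c ⟩
      T x ∨ ∼ (T c)       ≡⟨ cong (λ t → T x ∨ ∼ t) Tc≡c ⟩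
      T x ∨ ∼ c           ≡⟨ cong (T x ∨_) ∼c ⟩
      T x ∨ c             ∎

    T[c⇒x]≤c⇒Tx : T (c ⇒ x) ≤ c ⇒ T x
    T[c⇒x]≤c⇒Tx = begin
      T (c ⇒ x)   ≤⟨ T-⇒ c x ⟩
      T c ⇒ T x   ≡⟨ cong (_⇒ T x) Tc≡c ⟩
      c ⇒ T x     ∎

  D-isTenseFilter : IsTenseFilter 𝐀 (D 𝐀 S)
  D-isTenseFilter = record
    { nonempty = 𝟙 , 𝟙∈D
    ; upset    = D-upward
    ; ∗-closed = D-∗-closed
    ; G-closed = D-closed-under G t1G t4G t5G G-closed
    ; H-closed = D-closed-under H t1H t4H t5H H-closed
    }

mainTheorem17 : {a ℓ : Level} (𝐀 : TenseDRL a) (S : TenseDRL.Carrier 𝐀 → Set ℓ)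
    → IsTenseFilterC 𝐀 S → IsTenseFilter 𝐀 (D 𝐀 S)
mainTheorem17 = D-isTenseFilter
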